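{- For every set $P$ of prime numbers, the quasivariety $\mathsf{Q}_P$ has the amalgamation property.
   Context: Abelian groups are written multiplicatively as $\langle G,\cdot,{}^{ -1},1\rangle$. For a set $P$ of primes, $\mathsf{Q}_P$ is the quasivariety of abelian groups axiomatized by the quasi-equations $x^p\approx1\Rightarrow x\approx1$ for $p\in P$ (i.e. abelian groups with no element of order $p$ for any $p\in P$). A class of algebras has the amalgamation property if for all $\mathbf A,\mathbf B,\mathbf C$ in the class and embeddings $\phi_1:\mathbf A\to\mathbf B$, $\phi_2:\mathbf A\to\mathbf C$ there exist $\mathbf D$ in the class and embeddings $\psi_1:\mathbf B\to\mathbf D$, $\psi_2:\mathbf C\to\mathbf D$ with $\psi_1\circ\phi_1=\psi_2\circ\phi_2$. -}

module Defs where

open import Level using (Level; _⊔_; 0ℓ)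
open import Data.Nat using (ℕ; zero; suc)
open import Data.Nat.Primality using (Prime)
open import Data.Product using (Σ; _×_)
open import Relation.Unary using (Pred; _∈_)
open import Algebra.Bundles using (AbelianGroup)
open import Algebra.Morphism.Structures using (module GroupMorphisms)

IsSetOfPrimes : Pred ℕ 0ℓ → Set
IsSetOfPrimes P = ∀ p → p ∈ P → Prime p

module _ {c ℓ : Level} (G : AbelianGroup c ℓ) where
  open AbelianGroup G

  pow : Carrier → ℕ → Carrier
  pow x zero    = ε
  pow x (suc n) = x ∙ pow x n

  InQ : Pred ℕ 0ℓ → Set (c ⊔ ℓ)
  InQ P = ∀ p → p ∈ P → ∀ x → pow x p ≈ ε → x ≈ ε

IsEmbedding : {a ℓ₁ b ℓ₂ : Level} (G : AbelianGroup a ℓ₁) (H : AbelianGroup b ℓ₂) →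
              (AbelianGroup.Carrier G → AbelianGroup.Carrier H) → Set (a ⊔ ℓ₁ ⊔ ℓ₂)
IsEmbedding G H f =
  GroupMorphisms.IsGroupMonomorphism (AbelianGroup.rawGroup G) (AbelianGroup.rawGroup H) f

Embedding : {a ℓ₁ b ℓ₂ : Level} (G : AbelianGroup a ℓ₁) (H : AbelianGroup b ℓ₂) → Set (a ⊔ b ⊔ ℓ₁ ⊔ ℓ₂)
Embedding G H = Σ (AbelianGroup.Carrier G → AbelianGroup.Carrier H) (IsEmbedding G H)

-- The amalgam is the pushout (B × C) / {(f a, (g a)⁻¹)} with its P-torsion killed: D is B × C
-- modulo the P-radical K of the antidiagonal image of A, where u ∈ K iff uⁿ = (f a, (g a)⁻¹) for
-- some a and some product n of elements of P.  A quotient by a P-isolated subgroup has no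
-- P-torsion, and B embeds because (b, 1)ⁿ = (f a, (g a)⁻¹) forces g a = 1, so a = 1 and bⁿ = 1,
-- so b = 1 as B ∈ Q_P; symmetrically for C.
module Submission where

open import Defs
open import Level using (Level; _⊔_; 0ℓ; Lift; lift; lower)
open import Data.Nat using (ℕ; zero; suc; _*_)
open import Data.Nat.Properties using (*-identityˡ; *-assoc; *-comm)
open import Data.Product using (Σ; ∃; _×_; _,_; proj₁; proj₂)
open import Function using (id)
open import Relation.Unary using (Pred; _∈_; _⊆_)
open import Relation.Binary.Core using (Rel)
open import Relation.Binary.Definitions using (_Respects_)
open import Relation.Binary.PropositionalEquality as ≡ using (_≡_)
open import Algebra.Bundles using (AbelianGroup; RawGroup)
open import Algebra.Morphism.Structures using (module GroupMorphisms)
import Algebra.Construct.DirectProduct as DirectProduct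
import Algebra.Morphism.GroupMonomorphism as GroupMonomorphism
import Algebra.Morphism.Construct.Composition as Composition
import Algebra.Properties.AbelianGroup as AbelianGroupProperties
import Algebra.Properties.CommutativeSemigroup as CommutativeSemigroupProperties
import Algebra.Properties.CommutativeMonoid.Mult as MonoidMult
import Relation.Binary.Reasoning.Setoid as SetoidReasoning

open GroupMorphisms using (IsGroupHomomorphism; IsGroupMonomorphism)

data ProductOf (P : Pred ℕ 0ℓ) : ℕ → Set where
  one : ProductOf P 1
  _∷_ : ∀ {p n} → p ∈ P → ProductOf P n → ProductOf P (p * n)

productOf-* : ∀ {P m n} → ProductOf P m → ProductOf P n → ProductOf P (m * n)
productOf-* {n = n} one pn = ≡.subst (ProductOf _) (≡.sym (*-identityˡ n)) pn
productOf-* {n = n} (_∷_ {p} {m} p∈P pm) pn =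
  ≡.subst (ProductOf _) (≡.sym (*-assoc p m n)) (p∈P ∷ productOf-* pm pn)

module Powers {c ℓ} (G : AbelianGroup c ℓ) where
  open AbelianGroup G
  open AbelianGroupProperties G
  open MonoidMult commutativeMonoid using (×-congʳ; ×-distrib-+; ×-assocˡ)
    renaming (_×_ to _×ᴹ_)

  infixr 8 _^_
  _^_ : Carrier → ℕ → Carrier
  _^_ = pow G

  ^≡×ᴹ : ∀ x n → x ^ n ≡ n ×ᴹ x
  ^≡×ᴹ x zero    = ≡.refl
  ^≡×ᴹ x (suc n) = ≡.cong (x ∙_) (^≡×ᴹ x n)

  ^-congˡ : ∀ n {x y} → x ≈ y → x ^ n ≈ y ^ n
  ^-congˡ n {x} {y} x≈y rewrite ^≡×ᴹ x n | ^≡×ᴹ y n = ×-congʳ n x≈y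

  ^-distrib-∙ : ∀ x y n → (x ∙ y) ^ n ≈ x ^ n ∙ y ^ n
  ^-distrib-∙ x y n rewrite ^≡×ᴹ (x ∙ y) n | ^≡×ᴹ x n | ^≡×ᴹ y n = ×-distrib-+ x y n

  ^-assocʳ : ∀ x m n → (x ^ m) ^ n ≈ x ^ (m * n)
  ^-assocʳ x m n rewrite ^≡×ᴹ (x ^ m) n | ^≡×ᴹ x m | ^≡×ᴹ x (m * n) | *-comm m n =
    ×-assocˡ x n m

  x≈ε⇒xⁿ≈ε : ∀ n {x} → x ≈ ε → x ^ n ≈ ε
  x≈ε⇒xⁿ≈ε zero    x≈ε = refl
  x≈ε⇒xⁿ≈ε (suc n) x≈ε = trans (∙-cong x≈ε (x≈ε⇒xⁿ≈ε n x≈ε)) (identityˡ ε)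

  ⁻¹-^-comm : ∀ x n → (x ⁻¹) ^ n ≈ (x ^ n) ⁻¹
  ⁻¹-^-comm x zero    = sym ε⁻¹≈ε
  ⁻¹-^-comm x (suc n) = trans (∙-congˡ (⁻¹-^-comm x n)) (⁻¹-∙-comm x (x ^ n))

  InQ⇒productOf-torsionFree : ∀ {P} → InQ G P → ∀ {n} → ProductOf P n →
                              ∀ x → x ^ n ≈ ε → x ≈ ε
  InQ⇒productOf-torsionFree G∈Q one x x¹≈ε = trans (sym (identityʳ x)) x¹≈ε
  InQ⇒productOf-torsionFree G∈Q (_∷_ {p} {n} p∈P pn) x xᵖⁿ≈ε =
    G∈Q p p∈P x (InQ⇒productOf-torsionFree G∈Q pn (x ^ p) (trans (^-assocʳ x p n) xᵖⁿ≈ε))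

module Subgroups {c ℓ} (G : AbelianGroup c ℓ) where
  open AbelianGroup G
  open Powers G

  record IsSubgroup {k} (K : Pred Carrier k) : Set (c ⊔ ℓ ⊔ k) where
    field
      ∈-resp-≈  : K Respects _≈_
      ε∈        : ε ∈ K
      ∙-closed  : ∀ {x y} → x ∈ K → y ∈ K → x ∙ y ∈ K
      ⁻¹-closed : ∀ {x} → x ∈ K → x ⁻¹ ∈ K

    ^-closed : ∀ {x} n → x ∈ K → x ^ n ∈ K
    ^-closed zero    x∈K = ε∈
    ^-closed (suc n) x∈K = ∙-closed x∈K (^-closed n x∈K)

  open IsSubgroup

  module _ {a ℓa} {H : RawGroup a ℓa} {h : RawGroup.Carrier H → Carrier}
           (h-homo : IsGroupHomomorphism H rawGroup h) where
    open RawGroup H using () renaming (_∙_ to _∙ᴴ_; _⁻¹ to _⁻¹ᴴ; ε to εᴴ)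
    open IsGroupHomomorphism h-homo

    Image : Pred Carrier (a ⊔ ℓ)
    Image u = ∃ λ x → u ≈ h x

    image-isSubgroup : IsSubgroup Image
    image-isSubgroup = record
      { ∈-resp-≈  = λ { u≈v (x , u≈hx) → x , trans (sym u≈v) u≈hx }
      ; ε∈        = εᴴ , sym ε-homo
      ; ∙-closed  = λ { (x , u≈hx) (y , v≈hy) → x ∙ᴴ y , trans (∙-cong u≈hx v≈hy) (sym (homo x y)) }
      ; ⁻¹-closed = λ { (x , u≈hx) → x ⁻¹ᴴ , trans (⁻¹-cong u≈hx) (sym (⁻¹-homo x)) }
      }

  Isolated : ∀ {k} → Pred ℕ 0ℓ → Pred Carrier k → Set (c ⊔ k)
  Isolated P K = ∀ p → p ∈ P → ∀ x → x ^ p ∈ K → x ∈ K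

  module _ (P : Pred ℕ 0ℓ) {k} {K : Pred Carrier k} (K≤G : IsSubgroup K) where

    Radical : Pred Carrier k
    Radical x = ∃ λ n → ProductOf P n × x ^ n ∈ K

    ⊆-radical : K ⊆ Radical
    ⊆-radical {x} x∈K = 1 , one , ∈-resp-≈ K≤G (sym (identityʳ x)) x∈K

    radical-isolated : Isolated P Radical
    radical-isolated p p∈P x (n , pn , [xᵖ]ⁿ∈K) =
      p * n , p∈P ∷ pn , ∈-resp-≈ K≤G (^-assocʳ x p n) [xᵖ]ⁿ∈K

    radical-∙-closed : ∀ {x y} → x ∈ Radical → y ∈ Radical → x ∙ y ∈ Radical
    radical-∙-closed {x} {y} (m , pm , xᵐ∈K) (n , pn , yⁿ∈K) =
      m * n , productOf-* pm pn ,
      ∈-resp-≈ K≤G (sym split) (∙-closed K≤G (^-closed K≤G n xᵐ∈K) (^-closed K≤G m yⁿ∈K))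
      where
      open SetoidReasoning setoid

      split : (x ∙ y) ^ (m * n) ≈ (x ^ m) ^ n ∙ (y ^ n) ^ m
      split = begin
        (x ∙ y) ^ (m * n)           ≈⟨ ^-distrib-∙ x y (m * n) ⟩
        x ^ (m * n) ∙ y ^ (m * n)   ≈⟨ ∙-congˡ (reflexive (≡.cong (y ^_) (*-comm m n))) ⟩
        x ^ (m * n) ∙ y ^ (n * m)   ≈⟨ sym (∙-cong (^-assocʳ x m n) (^-assocʳ y n m)) ⟩
        (x ^ m) ^ n ∙ (y ^ n) ^ m   ∎

    radical-isSubgroup : IsSubgroup Radical
    radical-isSubgroup = record
      { ∈-resp-≈  = λ { x≈y (n , pn , xⁿ∈K) → n , pn , ∈-resp-≈ K≤G (^-congˡ n x≈y) xⁿ∈K }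
      ; ε∈        = ⊆-radical (ε∈ K≤G)
      ; ∙-closed  = radical-∙-closed
      ; ⁻¹-closed = λ { (n , pn , xⁿ∈K) →
          n , pn , ∈-resp-≈ K≤G (sym (⁻¹-^-comm _ n)) (⁻¹-closed K≤G xⁿ∈K) }
      }

module Quotient {c ℓ k} (G : AbelianGroup c ℓ) {K : Pred (AbelianGroup.Carrier G) k}
                (K≤G : Subgroups.IsSubgroup G K) where
  open AbelianGroup G
  open AbelianGroupProperties G
  open Powers G
  open Subgroups G using (Isolated)
  open Subgroups.IsSubgroup K≤G
  open SetoidReasoning setoid

  infix 4 _≈ᴷ_
  _≈ᴷ_ : Rel Carrier k
  x ≈ᴷ y = x - y ∈ K

  ≈⇒≈ᴷ : ∀ {x y} → x ≈ y → x ≈ᴷ y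
  ≈⇒≈ᴷ x≈y = ∈-resp-≈ (sym (x≈y⇒x∙y⁻¹≈ε x≈y)) ε∈

  -‿telescope : ∀ x y z → (x - y) ∙ (y - z) ≈ x - z
  -‿telescope x y z = begin
    (x - y) ∙ (y - z)       ≈⟨ assoc x (y ⁻¹) (y - z) ⟩
    x ∙ (y ⁻¹ ∙ (y - z))    ≈⟨ ∙-congˡ (assoc (y ⁻¹) y (z ⁻¹)) ⟨
    x ∙ ((y ⁻¹ ∙ y) - z)    ≈⟨ ∙-congˡ (∙-congʳ (inverseˡ y)) ⟩
    x ∙ (ε - z)             ≈⟨ ∙-congˡ (identityˡ (z ⁻¹)) ⟩
    x - z                   ∎

  -‿interchange : ∀ x y u v → (x ∙ u) - (y ∙ v) ≈ (x - y) ∙ (u - v)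
  -‿interchange x y u v = begin
    (x ∙ u) - (y ∙ v)       ≈⟨ ∙-congˡ (⁻¹-∙-comm y v) ⟨
    (x ∙ u) ∙ (y ⁻¹ ∙ v ⁻¹) ≈⟨ interchange x u (y ⁻¹) (v ⁻¹) ⟩
    (x - y) ∙ (u - v)       ∎
    where open CommutativeSemigroupProperties commutativeSemigroup using (interchange)

  quotient : AbelianGroup c k
  quotient = record
    { Carrier        = Carrier
    ; _≈_            = _≈ᴷ_
    ; _∙_            = _∙_
    ; ε              = ε
    ; _⁻¹            = _⁻¹
    ; isAbelianGroup = record
      { isGroup = record
        { isMonoid = record
          { isSemigroup = record
            { isMagma = record
              { isEquivalence = record
                { refl  = ≈⇒≈ᴷ refl
                ; sym   = λ {x} {y} x≈ᴷy → ∈-resp-≈ (⁻¹-anti-homo‿- x y) (⁻¹-closed x≈ᴷy)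
                ; trans = λ {x} {y} {z} x≈ᴷy y≈ᴷz →
                    ∈-resp-≈ (-‿telescope x y z) (∙-closed x≈ᴷy y≈ᴷz)
                }
              ; ∙-cong = λ {x} {y} {u} {v} x≈ᴷy u≈ᴷv →
                  ∈-resp-≈ (sym (-‿interchange x y u v)) (∙-closed x≈ᴷy u≈ᴷv)
              }
            ; assoc = λ x y z → ≈⇒≈ᴷ (assoc x y z)
            }
          ; identity = (λ x → ≈⇒≈ᴷ (identityˡ x)) , (λ x → ≈⇒≈ᴷ (identityʳ x))
          }
        ; inverse = (λ x → ≈⇒≈ᴷ (inverseˡ x)) , (λ x → ≈⇒≈ᴷ (inverseʳ x))
        ; ⁻¹-cong = λ {x} {y} x≈ᴷy → ∈-resp-≈ (sym (⁻¹-∙-comm x (y ⁻¹))) (⁻¹-closed x≈ᴷy)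
        }
      ; comm = λ x y → ≈⇒≈ᴷ (comm x y)
      }
    }

  quotientMap-isGroupHomomorphism : IsGroupHomomorphism rawGroup (AbelianGroup.rawGroup quotient) id
  quotientMap-isGroupHomomorphism = record
    { isMonoidHomomorphism = record
      { isMagmaHomomorphism = record
        { isRelHomomorphism = record { cong = ≈⇒≈ᴷ }
        ; homo              = λ x y → ≈⇒≈ᴷ refl
        }
      ; ε-homo = ≈⇒≈ᴷ refl
      }
    ; ⁻¹-homo = λ x → ≈⇒≈ᴷ refl
    }

  pow-quotient : ∀ x n → pow quotient x n ≡ x ^ n
  pow-quotient x zero    = ≡.refl
  pow-quotient x (suc n) = ≡.cong (x ∙_) (pow-quotient x n)

  quotient-InQ : ∀ {P} → Isolated P K → InQ quotient P
  quotient-InQ K-isolated p p∈P x xᵖ≈ᴷε =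
    ∈-resp-≈ (sym (x-ε≈x x))
      (K-isolated p p∈P x (∈-resp-≈ (trans (x-ε≈x _) (reflexive (pow-quotient x p))) xᵖ≈ᴷε))
    where
    x-ε≈x : ∀ x → x - ε ≈ x
    x-ε≈x x = trans (∙-congˡ ε⁻¹≈ε) (identityʳ x)

-- Needed only because the amalgam must have carrier level c ⊔ ℓ, while B × C lives at level c.
liftCarrier : ∀ {c ℓ} ℓ′ → AbelianGroup c ℓ → AbelianGroup (c ⊔ ℓ′) ℓ
liftCarrier {c} {ℓ} ℓ′ G = record
  { Carrier        = RawGroup.Carrier lifted
  ; _≈_            = RawGroup._≈_ lifted
  ; _∙_            = RawGroup._∙_ lifted
  ; ε              = RawGroup.ε lifted
  ; _⁻¹            = RawGroup._⁻¹ lifted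
  ; isAbelianGroup = GroupMonomorphism.isAbelianGroup lower-isGroupMonomorphism isAbelianGroup
  }
  where
  open AbelianGroup G

  lifted : RawGroup (c ⊔ ℓ′) ℓ
  lifted = record
    { Carrier = Lift ℓ′ Carrier
    ; _≈_     = λ x y → lower x ≈ lower y
    ; _∙_     = λ x y → lift (lower x ∙ lower y)
    ; ε       = lift ε
    ; _⁻¹     = λ x → lift (lower x ⁻¹)
    }

  lower-isGroupMonomorphism : IsGroupMonomorphism lifted rawGroup lower
  lower-isGroupMonomorphism = record
    { isGroupHomomorphism = record
      { isMonoidHomomorphism = record
        { isMagmaHomomorphism = record
          { isRelHomomorphism = record { cong = id }
          ; homo              = λ x y → refl
          }
        ; ε-homo = refl
        }
      ; ⁻¹-homo = λ x → refl
      }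
    ; injective = id
    }

module Amalgam (P : Pred ℕ 0ℓ) {c ℓ} (A B C : AbelianGroup c ℓ)
               (B∈Q : InQ B P) (C∈Q : InQ C P)
               (φ₁ : Embedding A B) (φ₂ : Embedding A C) where
  private
    module A = AbelianGroup A
    module B = AbelianGroup B
    module C = AbelianGroup C
    module BP = AbelianGroupProperties B
    module CP = AbelianGroupProperties C
    module B^ = Powers B
    module C^ = Powers C
    f : A.Carrier → B.Carrier
    f = proj₁ φ₁

    g : A.Carrier → C.Carrier
    g = proj₁ φ₂

    module F = IsGroupMonomorphism (proj₂ φ₁)
    module G = IsGroupMonomorphism (proj₂ φ₂)

  B⊕C : AbelianGroup (c ⊔ ℓ) ℓ
  B⊕C = liftCarrier ℓ (DirectProduct.abelianGroup B C)

  open AbelianGroup B⊕C using (rawGroup) renaming (Carrier to B⊕C-Carrier)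
  open Subgroups B⊕C

  ι₁ : B.Carrier → B⊕C-Carrier
  ι₁ b = lift (b , C.ε)

  ι₂ : C.Carrier → B⊕C-Carrier
  ι₂ c = lift (B.ε , c)

  antidiagonal : A.Carrier → B⊕C-Carrier
  antidiagonal a = lift (f a , g a C.⁻¹)

  ι₁-isGroupHomomorphism : IsGroupHomomorphism B.rawGroup rawGroup ι₁
  ι₁-isGroupHomomorphism = record
    { isMonoidHomomorphism = record
      { isMagmaHomomorphism = record
        { isRelHomomorphism = record { cong = λ b≈b′ → b≈b′ , C.refl }
        ; homo              = λ _ _ → B.refl , C.sym (C.identityˡ C.ε)
        }
      ; ε-homo = B.refl , C.refl
      }
    ; ⁻¹-homo = λ _ → B.refl , C.sym CP.ε⁻¹≈ε
    }

  ι₂-isGroupHomomorphism : IsGroupHomomorphism C.rawGroup rawGroup ι₂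
  ι₂-isGroupHomomorphism = record
    { isMonoidHomomorphism = record
      { isMagmaHomomorphism = record
        { isRelHomomorphism = record { cong = λ c≈c′ → B.refl , c≈c′ }
        ; homo              = λ _ _ → B.sym (B.identityˡ B.ε) , C.refl
        }
      ; ε-homo = B.refl , C.refl
      }
    ; ⁻¹-homo = λ _ → B.sym BP.ε⁻¹≈ε , C.refl
    }

  antidiagonal-isGroupHomomorphism : IsGroupHomomorphism A.rawGroup rawGroup antidiagonal
  antidiagonal-isGroupHomomorphism = record
    { isMonoidHomomorphism = record
      { isMagmaHomomorphism = record
        { isRelHomomorphism = record { cong = λ a≈a′ → F.⟦⟧-cong a≈a′ , C.⁻¹-cong (G.⟦⟧-cong a≈a′) }
        ; homo              = λ a a′ →
            F.∙-homo a a′ , C.trans (C.⁻¹-cong (G.∙-homo a a′)) (C.sym (CP.⁻¹-∙-comm (g a) (g a′)))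
        }
      ; ε-homo = F.ε-homo , C.trans (C.⁻¹-cong G.ε-homo) CP.ε⁻¹≈ε
      }
    ; ⁻¹-homo = λ a → F.⁻¹-homo a , C.⁻¹-cong (G.⁻¹-homo a)
    }

  image≤B⊕C : IsSubgroup (Image antidiagonal-isGroupHomomorphism)
  image≤B⊕C = image-isSubgroup antidiagonal-isGroupHomomorphism

  K : Pred B⊕C-Carrier (c ⊔ ℓ)
  K = Radical P image≤B⊕C

  K≤B⊕C : IsSubgroup K
  K≤B⊕C = radical-isSubgroup P image≤B⊕C

  open Quotient B⊕C K≤B⊕C using (quotient; quotient-InQ; quotientMap-isGroupHomomorphism)

  D : AbelianGroup (c ⊔ ℓ) (c ⊔ ℓ)
  D = quotient

  D-InQ : InQ D P
  D-InQ = quotient-InQ (radical-isolated P image≤B⊕C)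

  ∈K⇒witness : ∀ {x y} → lift (x , y) ∈ K →
               ∃ λ n → ProductOf P n × ∃ λ a → (pow B x n B.≈ f a) × (pow C y n C.≈ g a C.⁻¹)
  ∈K⇒witness (n , pn , a , xⁿ≈fa , yⁿ≈ga⁻¹) =
    n , pn , a ,
    B.trans (B.reflexive (≡.sym (pow-proj₁ n))) xⁿ≈fa ,
    C.trans (C.reflexive (≡.sym (pow-proj₂ n))) yⁿ≈ga⁻¹
    where
    pow-proj₁ : ∀ {u} n → proj₁ (lower (pow B⊕C u n)) ≡ pow B (proj₁ (lower u)) n
    pow-proj₁         zero    = ≡.refl
    pow-proj₁ {u = u} (suc n) = ≡.cong (proj₁ (lower u) B.∙_) (pow-proj₁ n)

    pow-proj₂ : ∀ {u} n → proj₂ (lower (pow B⊕C u n)) ≡ pow C (proj₂ (lower u)) n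
    pow-proj₂         zero    = ≡.refl
    pow-proj₂ {u = u} (suc n) = ≡.cong (proj₂ (lower u) C.∙_) (pow-proj₂ n)

  fst-trivial : ∀ {x y} → y C.≈ C.ε → lift (x , y) ∈ K → x B.≈ B.ε
  fst-trivial {x} y≈ε x,y∈K with ∈K⇒witness x,y∈K
  ... | n , pn , a , xⁿ≈fa , yⁿ≈ga⁻¹ =
    B^.InQ⇒productOf-torsionFree B∈Q pn x (B.trans xⁿ≈fa (B.trans (F.⟦⟧-cong a≈ε) F.ε-homo))
    where
    ga⁻¹≈ε⁻¹ : g a C.⁻¹ C.≈ C.ε C.⁻¹
    ga⁻¹≈ε⁻¹ = C.trans (C.sym yⁿ≈ga⁻¹) (C.trans (C^.x≈ε⇒xⁿ≈ε n y≈ε) (C.sym CP.ε⁻¹≈ε))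

    a≈ε : a A.≈ A.ε
    a≈ε = G.injective (C.trans (CP.⁻¹-injective ga⁻¹≈ε⁻¹) (C.sym G.ε-homo))

  snd-trivial : ∀ {x y} → x B.≈ B.ε → lift (x , y) ∈ K → y C.≈ C.ε
  snd-trivial {y = y} x≈ε x,y∈K with ∈K⇒witness x,y∈K
  ... | n , pn , a , xⁿ≈fa , yⁿ≈ga⁻¹ =
    C^.InQ⇒productOf-torsionFree C∈Q pn y
      (C.trans yⁿ≈ga⁻¹ (C.trans (C.⁻¹-cong (C.trans (G.⟦⟧-cong a≈ε) G.ε-homo)) CP.ε⁻¹≈ε))
    where
    a≈ε : a A.≈ A.ε
    a≈ε = F.injective (B.trans (B.sym xⁿ≈fa)
            (B.trans (B^.x≈ε⇒xⁿ≈ε n x≈ε) (B.sym F.ε-homo)))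

  ψ₁ : Embedding B D
  ψ₁ = ι₁ , record
    { isGroupHomomorphism = Composition.isGroupHomomorphism (AbelianGroup.trans D)
        ι₁-isGroupHomomorphism quotientMap-isGroupHomomorphism
    ; injective = λ {b} {b′} ι₁b≈ι₁b′ →
        BP.x∙y⁻¹≈ε⇒x≈y b b′ (fst-trivial (C.inverseʳ C.ε) ι₁b≈ι₁b′)
    }

  ψ₂ : Embedding C D
  ψ₂ = ι₂ , record
    { isGroupHomomorphism = Composition.isGroupHomomorphism (AbelianGroup.trans D)
        ι₂-isGroupHomomorphism quotientMap-isGroupHomomorphism
    ; injective = λ {c} {c′} ι₂c≈ι₂c′ →
        CP.x∙y⁻¹≈ε⇒x≈y c c′ (snd-trivial (B.inverseʳ B.ε) ι₂c≈ι₂c′)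
    }

  ψ₁∘φ₁≈ψ₂∘φ₂ : ∀ a → AbelianGroup._≈_ D (ι₁ (f a)) (ι₂ (g a))
  ψ₁∘φ₁≈ψ₂∘φ₂ a = ⊆-radical P image≤B⊕C
    (a , B.trans (B.∙-congˡ BP.ε⁻¹≈ε) (B.identityʳ (f a)) , C.identityˡ (g a C.⁻¹))

proposition3p2 : (P : Pred ℕ 0ℓ) → IsSetOfPrimes P →
    {c ℓ : Level} (A B C : AbelianGroup c ℓ) →
    InQ A P → InQ B P → InQ C P →
    (φ₁ : Embedding A B) (φ₂ : Embedding A C) →
    Σ (AbelianGroup (c ⊔ ℓ) (c ⊔ ℓ)) λ D →
      InQ D P ×
      Σ (Embedding B D) λ ψ₁ →
      Σ (Embedding C D) λ ψ₂ →
        ∀ a → AbelianGroup._≈_ D (proj₁ ψ₁ (proj₁ φ₁ a)) (proj₁ ψ₂ (proj₁ φ₂ a))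
proposition3p2 P _ A B C _ B∈Q C∈Q φ₁ φ₂ = D , D-InQ , ψ₁ , ψ₂ , ψ₁∘φ₁≈ψ₂∘φ₂
  where open Amalgam P A B C B∈Q C∈Q φ₁ φ₂
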